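{- Let $n\in\mathbb{N}$ and let $\mathsf{F}$ be a labeled forest with $n$ vertices. Then the chain group $G_{\mathsf{F}}$ is abelian if and only if $\mathsf{F}$ is a disjoint union of paths.
   Context: A forest is a finite acyclic graph; a labeled forest with $n$ vertices has vertex set $[n]$. A path in a graph is a sequence of pairwise distinct vertices $v_1,\dots,v_m$ with $v_i$ adjacent to $v_{i+1}$ for all $i$; it is maximal if it is not strictly contained in another path. A path graph is a tree with exactly one maximal path (all vertices of degree at most $2$). The chain group $G_{\mathsf{F}}$ is the subgroup of $S_n$ generated by all cycles $(i_1\ \cdots\ i_m)$ such that $i_1,\dots,i_m$ is a maximal path of $\mathsf{F}$ (a one-vertex path gives the identity). -}

module Defs where

open import Data.Nat using (ℕ; suc; _<_; _≥_)
open import Data.Fin using (Fin)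
open import Data.Bool using (Bool; T)
open import Data.List using (List; []; _∷_; length; last)
open import Data.List.Membership.Propositional using (_∈_; _∉_)
open import Data.List.Relation.Unary.Unique.Propositional using (Unique)
open import Data.Product using (Σ; ∃; _×_; _,_)
open import Data.Maybe using (just)
open import Relation.Nullary using (¬_)
open import Relation.Binary.PropositionalEquality using (_≡_)
open import Data.Fin.Permutation using (Permutation′; _⟨$⟩ʳ_; _∘ₚ_; transpose; flip)
  renaming (id to idₚ)

record Graph (n : ℕ) : Set where
  field
    edge  : Fin n → Fin n → Bool
    sym   : ∀ u v → T (edge u v) → T (edge v u)
    irref : ∀ v → ¬ T (edge v v)

open Graph public

Adj : ∀ {n} → Graph n → Fin n → Fin n → Set
Adj G u v = T (edge G u v)

Chain : ∀ {n} → Graph n → List (Fin n) → Set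
Chain G []             = Data.Unit.⊤ where import Data.Unit
Chain G (x ∷ [])       = Data.Unit.⊤ where import Data.Unit
Chain G (x ∷ y ∷ rest) = Adj G x y × Chain G (y ∷ rest)

IsPath : ∀ {n} → Graph n → List (Fin n) → Set
IsPath G P = 1 Data.Nat.≤ length P × Unique P × Chain G P
  where import Data.Nat

IsCycle : ∀ {n} → Graph n → List (Fin n) → Set
IsCycle G []      = Data.Empty.⊥ where import Data.Empty
IsCycle G (x ∷ P) =
  3 Data.Nat.≤ length (x ∷ P) × Unique (x ∷ P) × Chain G (x ∷ P)
  × (∀ y → last (x ∷ P) ≡ just y → Adj G y x)
  where import Data.Nat

IsForest : ∀ {n} → Graph n → Set
IsForest G = ∀ C → ¬ IsCycle G C

_⊂ᵥ_ : ∀ {n} → List (Fin n) → List (Fin n) → Set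
P ⊂ᵥ Q = (∀ v → v ∈ P → v ∈ Q) × ∃ λ w → w ∈ Q × w ∉ P

IsMaximalPath : ∀ {n} → Graph n → List (Fin n) → Set
IsMaximalPath G P = IsPath G P × (∀ Q → IsPath G Q → ¬ (P ⊂ᵥ Q))

data Reach {n} (G : Graph n) (u : Fin n) : Fin n → Set where
  here : Reach G u u
  step : ∀ {v w} → Reach G u v → Adj G v w → Reach G u w

-- every connected component is a path graph: the vertices of the
-- component of v can be traversed by a single path of G
IsDisjointUnionOfPaths : ∀ {n} → Graph n → Set
IsDisjointUnionOfPaths G =
  ∀ v → ∃ λ P → IsPath G P × (∀ u → Reach G v u → u ∈ P)

-- cycle (i₁ i₂ … i_m) : i₁ ↦ i₂ ↦ … ↦ i_m ↦ i₁ ;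
-- note π ∘ₚ ρ applies π first, so this is (i₁ i₂)(i₂ i₃)…(i_{m-1} i_m)
-- in right-to-left notation
cycle : ∀ {n} → List (Fin n) → Permutation′ n
cycle []             = idₚ
cycle (x ∷ [])       = idₚ
cycle (x ∷ y ∷ rest) = cycle (y ∷ rest) ∘ₚ transpose x y

_≈ₚ_ : ∀ {n} → Permutation′ n → Permutation′ n → Set
π ≈ₚ ρ = ∀ i → π ⟨$⟩ʳ i ≡ ρ ⟨$⟩ʳ i

data InChainGroup {n} (G : Graph n) : Permutation′ n → Set where
  gen  : ∀ P → IsMaximalPath G P → InChainGroup G (cycle P)
  one  : InChainGroup G idₚ
  mul  : ∀ {π ρ} → InChainGroup G π → InChainGroup G ρ → InChainGroup G (π ∘ₚ ρ)
  inv  : ∀ {π} → InChainGroup G π → InChainGroup G (flip π)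
  resp : ∀ {π ρ} → π ≈ₚ ρ → InChainGroup G π → InChainGroup G ρ

ChainGroupAbelian : ∀ {n} → Graph n → Set
ChainGroupAbelian G =
  ∀ π ρ → InChainGroup G π → InChainGroup G ρ → (π ∘ₚ ρ) ≈ₚ (ρ ∘ₚ π)

{-# OPTIONS --safe #-}
module Submission where

-- If every component is a path, a maximal path is a whole component, so two maximal paths are
-- either vertex-disjoint or have the same vertex set. In the latter case, since a forest has no
-- chords, one runs along the other forwards or backwards, so their cycles are equal or inverse;
-- disjoint cycles commute too. Conversely, let the chain group be abelian and let P be a maximal
-- path through v. An edge a–b leaving P at an endpoint would extend P. If a is interior, with
-- neighbours x and y on P, take a maximal path Q through x, a, b: evaluating
-- cycle P ∘ₚ cycle Q = cycle Q ∘ₚ cycle P at x or at b forces b = y or a = y. Hence P covers the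
-- component of v.

open import Defs renaming (sym to adj-sym)
open import Data.Nat using (ℕ; zero; suc; _+_; _≤_; _<_; z≤n; s≤s; _≤?_)
open import Data.Nat.Properties using (<⇒≱; +-suc; m≤n+m)
open import Data.Fin using (Fin; _≟_)
open import Data.Unit using (tt)
open import Data.Empty using (⊥-elim)
open import Data.Product using (∃; _×_; _,_; proj₁; proj₂)
import Data.Product as Product
open import Data.Sum using (_⊎_; inj₁; inj₂)
import Data.Sum as Sum
open import Data.Maybe using (just)
open import Data.Maybe.Properties using (just-injective)
open import Data.List
  using (List; []; _∷_; [_]; _++_; _∷ʳ_; length; last; allFin; filter; cartesianProductWith)
open import Data.List.Properties using (length-++; ++-assoc; length-tabulate)
open import Data.List.Relation.Unary.Any using (here; there; any?)
open import Data.List.Relation.Unary.All using ([]; _∷_)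
import Data.List.Relation.Unary.All as All
open import Data.List.Relation.Unary.All.Properties using (all-filter; ¬Any⇒All¬)
import Data.List.Relation.Unary.All.Properties as Allₚ
open import Data.List.Relation.Unary.Unique.Propositional using (Unique; []; _∷_)
open import Data.List.Relation.Unary.Unique.Propositional.Properties using (Unique[x∷xs]⇒x∉xs)
import Data.List.Relation.Unary.Unique.Propositional.Properties as Uniqueₚ
open import Data.List.Membership.Propositional using (_∈_; _∉_; find; lose)
open import Data.List.Membership.Propositional.Properties
  using (∈-∃++; ∈-++⁻; ∈-++⁺ˡ; ∈-++⁺ʳ; ∈-allFin; ∈-filter⁺; ∈-cartesianProductWith⁺)
open import Data.List.Relation.Binary.Subset.Propositional using (_⊆_)
open import Data.List.Extrema.Nat using (argmax; argmax-all; f[xs]≤f[argmax])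
open import Relation.Nullary using (¬_; Dec; yes; no)
open import Relation.Nullary.Decidable using (_×-dec_; T?)
open import Relation.Unary using (Decidable)
open import Relation.Binary.PropositionalEquality hiding ([_])
open import Data.Fin.Permutation
  using (Permutation′; _⟨$⟩ʳ_; _∘ₚ_; transpose; flip; inverseˡ; inverseʳ)
  renaming (id to idₚ)
open import Function.Base using (_∘_; _$_)
open import Function.Bundles using (_⇔_; mk⇔)

private
  variable
    A : Set
    n k : ℕ
    a b u u′ w w′ x y z : A
    xs ys zs : List A
    π ρ σ : Permutation′ n

-- Lists

data Consecutive {A : Set} (u w : A) : List A → Set where
  here  : Consecutive u w (u ∷ w ∷ xs)
  there : Consecutive u w xs → Consecutive u w (x ∷ xs)

data Last {A : Set} (z : A) : List A → Set where
  here  : Last z [ z ]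
  there : Last z xs → Last z (x ∷ xs)

successor-∈-tail : Consecutive u w (x ∷ xs) → w ∈ xs
successor-∈-tail here = here refl
successor-∈-tail {xs = _ ∷ _} (there c) = there (successor-∈-tail c)

consecutive-∈ˡ : Consecutive u w xs → u ∈ xs
consecutive-∈ˡ here = here refl
consecutive-∈ˡ (there c) = there (consecutive-∈ˡ c)

consecutive-∈ʳ : Consecutive u w xs → w ∈ xs
consecutive-∈ʳ {xs = _ ∷ _} c = there (successor-∈-tail c)

last-∈ : Last z xs → z ∈ xs
last-∈ here = here refl
last-∈ (there l) = there (last-∈ l)

last-unique : Last a xs → Last b xs → a ≡ b
last-unique here here = refl
last-unique (there l) (there l′) = last-unique l l′

successor-or-last : x ∈ xs → (∃ λ w → Consecutive x w xs) ⊎ Last x xs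
successor-or-last {xs = _ ∷ []} (here refl) = inj₂ here
successor-or-last {xs = _ ∷ w ∷ _} (here refl) = inj₁ (w , here)
successor-or-last (there x∈) = Sum.map (Product.map₂ there) there (successor-or-last x∈)

head-or-predecessor : x ∈ y ∷ xs → x ≡ y ⊎ ∃ λ u → Consecutive u x (y ∷ xs)
head-or-predecessor (here x≡y) = inj₁ x≡y
head-or-predecessor {xs = _ ∷ _} (there x∈) with head-or-predecessor x∈
... | inj₁ refl = inj₂ (_ , here)
... | inj₂ (u , c) = inj₂ (u , there c)

no-successor⇒last : x ∈ xs → (∀ {w} → ¬ Consecutive x w xs) → Last x xs
no-successor⇒last x∈ no-successor with successor-or-last x∈
... | inj₁ (_ , c) = ⊥-elim (no-successor c)
... | inj₂ l = l

no-predecessor⇒head : x ∈ y ∷ ys → (∀ {u} → ¬ Consecutive u x (y ∷ ys)) → x ≡ y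
no-predecessor⇒head x∈ no-predecessor with head-or-predecessor x∈
... | inj₁ x≡y = x≡y
... | inj₂ (_ , c) = ⊥-elim (no-predecessor c)

head-no-predecessor : Unique (x ∷ xs) → ¬ Consecutive u x (x ∷ xs)
head-no-predecessor uniq c = Unique[x∷xs]⇒x∉xs uniq (successor-∈-tail c)

last-no-successor : Unique xs → Last z xs → ¬ Consecutive z w xs
last-no-successor uniq (there l) here = Unique[x∷xs]⇒x∉xs uniq (last-∈ l)
last-no-successor (_ ∷ uniq) (there l) (there c) = last-no-successor uniq l c

successor-unique : Unique xs → Consecutive u w xs → Consecutive u w′ xs → w ≡ w′
successor-unique _ here here = refl
successor-unique uniq here (there c) = ⊥-elim (Unique[x∷xs]⇒x∉xs uniq (consecutive-∈ˡ c))
successor-unique uniq (there c) here = ⊥-elim (Unique[x∷xs]⇒x∉xs uniq (consecutive-∈ˡ c))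
successor-unique (_ ∷ uniq) (there c) (there c′) = successor-unique uniq c c′

predecessor-unique : Unique xs → Consecutive u w xs → Consecutive u′ w xs → u ≡ u′
predecessor-unique _ here here = refl
predecessor-unique (_ ∷ uniq) here (there c) = ⊥-elim (head-no-predecessor uniq c)
predecessor-unique (_ ∷ uniq) (there c) here = ⊥-elim (head-no-predecessor uniq c)
predecessor-unique (_ ∷ uniq) (there c) (there c′) = predecessor-unique uniq c c′

consecutive-≢ : Unique xs → Consecutive u w xs → u ≢ w
consecutive-≢ (u≢ ∷ _) here = All.head u≢
consecutive-≢ (_ ∷ uniq) (there c) = consecutive-≢ uniq c

consecutive-asym : Unique xs → Consecutive u w xs → ¬ Consecutive w u xs
consecutive-asym uniq here here = consecutive-≢ uniq here refl
consecutive-asym uniq here (there c) = Unique[x∷xs]⇒x∉xs uniq (consecutive-∈ʳ c)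
consecutive-asym uniq (there c) here = Unique[x∷xs]⇒x∉xs uniq (consecutive-∈ʳ c)
consecutive-asym (_ ∷ uniq) (there c) (there c′) = consecutive-asym uniq c c′

Follows Reverses : List A → List A → Set
Follows ys xs = ∀ {u w} → Consecutive u w ys → Consecutive u w xs
Reverses ys xs = ∀ {u w} → Consecutive u w ys → Consecutive w u xs

follows-or-reverses :
  Unique xs → Unique ys →
  (∀ {u w} → Consecutive u w ys → Consecutive u w xs ⊎ Consecutive w u xs) →
  Follows ys xs ⊎ Reverses ys xs
follows-or-reverses {ys = []} _ _ _ = inj₁ λ ()
follows-or-reverses {ys = _ ∷ []} _ _ _ = inj₁ λ { (there ()) }
follows-or-reverses {ys = _ ∷ _ ∷ []} _ _ along with along here
... | inj₁ c = inj₁ λ { here → c ; (there (there ())) }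
... | inj₂ c = inj₂ λ { here → c ; (there (there ())) }
follows-or-reverses {ys = _ ∷ _ ∷ _ ∷ _} xs-unique ys-unique@(_ ∷ ys-unique′) along
  with along here | follows-or-reverses xs-unique ys-unique′ (along ∘ there)
... | inj₁ c | inj₁ f = inj₁ λ { here → c ; (there c′) → f c′ }
... | inj₂ c | inj₂ r = inj₂ λ { here → c ; (there c′) → r c′ }
... | inj₁ c | inj₂ r =
  ⊥-elim (Unique[x∷xs]⇒x∉xs ys-unique (there (here (predecessor-unique xs-unique c (r here)))))
... | inj₂ c | inj₁ f =
  ⊥-elim (Unique[x∷xs]⇒x∉xs ys-unique (there (here (successor-unique xs-unique c (f here)))))

-- In the mixed cases a pair would be consecutive in both orders, so both lists have at most one
-- entry and both alternatives hold vacuously.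
mutually-follow-or-reverse :
  Unique xs → Unique ys →
  Follows ys xs ⊎ Reverses ys xs → Follows xs ys ⊎ Reverses xs ys →
  (Follows ys xs × Follows xs ys) ⊎ (Reverses ys xs × Reverses xs ys)
mutually-follow-or-reverse _ _ (inj₁ f) (inj₁ f′) = inj₁ (f , f′)
mutually-follow-or-reverse _ _ (inj₂ r) (inj₂ r′) = inj₂ (r , r′)
mutually-follow-or-reverse xs-unique _ (inj₁ f) (inj₂ r′) =
  inj₁ (f , λ c → ⊥-elim (consecutive-asym xs-unique c (f (r′ c))))
mutually-follow-or-reverse _ ys-unique (inj₂ r) (inj₁ f′) =
  inj₁ ((λ c → ⊥-elim (consecutive-asym ys-unique c (f′ (r c)))) , f′)

∈-remove : (ys : List A) → x ∈ ys ++ y ∷ zs → x ≢ y → x ∈ ys ++ zs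
∈-remove ys x∈ x≢y with ∈-++⁻ ys x∈
... | inj₁ x∈ys = ∈-++⁺ˡ x∈ys
... | inj₂ (here x≡y) = ⊥-elim (x≢y x≡y)
... | inj₂ (there x∈zs) = ∈-++⁺ʳ ys x∈zs

length-mono-⊆ : Unique xs → xs ⊆ ys → length xs ≤ length ys
length-mono-⊆ {xs = []} _ _ = z≤n
length-mono-⊆ {xs = x ∷ xs} (x≢ ∷ uniq) sub with ys₁ , ys₂ , refl ← ∈-∃++ (sub (here refl)) =
  subst (suc (length xs) ≤_) (sym length-middle) (s≤s (length-mono-⊆ uniq sub′))
  where
  sub′ : xs ⊆ ys₁ ++ ys₂
  sub′ y∈ = ∈-remove ys₁ (sub (there y∈)) (λ y≡x → All.lookup x≢ y∈ (sym y≡x))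
  length-middle : length (ys₁ ++ x ∷ ys₂) ≡ suc (length (ys₁ ++ ys₂))
  length-middle = begin
    length (ys₁ ++ x ∷ ys₂)        ≡⟨ length-++ ys₁ ⟩
    length ys₁ + suc (length ys₂)  ≡⟨ +-suc (length ys₁) _ ⟩
    suc (length ys₁ + length ys₂)  ≡⟨ cong suc (sym (length-++ ys₁)) ⟩
    suc (length (ys₁ ++ ys₂))      ∎
    where open ≡-Reasoning

unique-++⁻ˡ : (xs : List A) → Unique (xs ++ ys) → Unique xs
unique-++⁻ˡ [] _ = []
unique-++⁻ˡ (x ∷ xs) (x≢ ∷ uniq) = Allₚ.++⁻ˡ xs x≢ ∷ unique-++⁻ˡ xs uniq

last-∷ʳ : (xs : List A) → last (xs ∷ʳ z) ≡ just z
last-∷ʳ [] = refl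
last-∷ʳ (_ ∷ []) = refl
last-∷ʳ (_ ∷ y ∷ ys) = last-∷ʳ (y ∷ ys)

_∈?_ : (x : Fin n) (xs : List (Fin n)) → Dec (x ∈ xs)
x ∈? xs = any? (x ≟_) xs

listsOfLength≤ : ℕ → List (List (Fin n))
listsOfLength≤ zero = [ [] ]
listsOfLength≤ {n} (suc k) = [] ∷ cartesianProductWith _∷_ (allFin n) (listsOfLength≤ k)

∈-listsOfLength≤ : {xs : List (Fin n)} → length xs ≤ k → xs ∈ listsOfLength≤ k
∈-listsOfLength≤ {k = zero} {xs = []} _ = here refl
∈-listsOfLength≤ {k = suc k} {xs = []} _ = here refl
∈-listsOfLength≤ {k = suc k} {xs = x ∷ xs} (s≤s len≤k) =
  there (∈-cartesianProductWith⁺ _∷_ (∈-allFin x) (∈-listsOfLength≤ len≤k))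

unique⇒length≤n : {xs : List (Fin n)} → Unique xs → length xs ≤ n
unique⇒length≤n {n} {xs} uniq =
  subst (length xs ≤_) (length-tabulate {n = n} (λ i → i))
        (length-mono-⊆ uniq (λ {z} _ → ∈-allFin z))

-- Permutations

transpose-left : (i j : Fin n) → transpose i j ⟨$⟩ʳ i ≡ j
transpose-left i j with i ≟ i
... | yes _ = refl
... | no i≢i = ⊥-elim (i≢i refl)

transpose-right : (i j : Fin n) → transpose i j ⟨$⟩ʳ j ≡ i
transpose-right i j with j ≟ i
... | yes j≡i = j≡i
... | no _ with j ≟ j
...   | yes _ = refl
...   | no j≢j = ⊥-elim (j≢j refl)

transpose-other : (i j : Fin n) {k : Fin n} → k ≢ i → k ≢ j → transpose i j ⟨$⟩ʳ k ≡ k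
transpose-other i j {k} k≢i k≢j with k ≟ i
... | yes k≡i = ⊥-elim (k≢i k≡i)
... | no _ with k ≟ j
...   | yes k≡j = ⊥-elim (k≢j k≡j)
...   | no _ = refl

record Commute (π ρ : Permutation′ n) : Set where
  constructor mkCommute
  field pointwise : (π ∘ₚ ρ) ≈ₚ (ρ ∘ₚ π)

commute-sym : Commute π ρ → Commute ρ π
commute-sym (mkCommute c) = mkCommute λ i → sym (c i)

commute-id : Commute π idₚ
commute-id = mkCommute λ _ → refl

commute-∘ : Commute π ρ → Commute π σ → Commute π (ρ ∘ₚ σ)
commute-∘ {ρ = ρ} {σ = σ} (mkCommute c) (mkCommute d) =
  mkCommute λ i → trans (cong (σ ⟨$⟩ʳ_) (c i)) (d (ρ ⟨$⟩ʳ i))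

commute-flip : Commute π ρ → Commute π (flip ρ)
commute-flip {π = π} {ρ = ρ} (mkCommute c) = mkCommute λ i → begin
  flip ρ ⟨$⟩ʳ (π ⟨$⟩ʳ i)                        ≡⟨ cong (λ k → flip ρ ⟨$⟩ʳ (π ⟨$⟩ʳ k)) (sym (inverseʳ ρ)) ⟩
  flip ρ ⟨$⟩ʳ (π ⟨$⟩ʳ (ρ ⟨$⟩ʳ (flip ρ ⟨$⟩ʳ i))) ≡⟨ cong (flip ρ ⟨$⟩ʳ_) (sym (c (flip ρ ⟨$⟩ʳ i))) ⟩
  flip ρ ⟨$⟩ʳ (ρ ⟨$⟩ʳ (π ⟨$⟩ʳ (flip ρ ⟨$⟩ʳ i))) ≡⟨ inverseˡ ρ ⟩
  π ⟨$⟩ʳ (flip ρ ⟨$⟩ʳ i)                        ∎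
  where open ≡-Reasoning

commute-resp : ρ ≈ₚ σ → Commute π ρ → Commute π σ
commute-resp {π = π} ρ≈σ (mkCommute c) =
  mkCommute λ i → trans (sym (ρ≈σ (π ⟨$⟩ʳ i))) (trans (c i) (cong (π ⟨$⟩ʳ_) (ρ≈σ i)))

≈ₚ⇒commute : π ≈ₚ ρ → Commute π ρ
≈ₚ⇒commute {ρ = ρ} π≈ρ = mkCommute λ i → trans (cong (ρ ⟨$⟩ʳ_) (π≈ρ i)) (sym (π≈ρ (ρ ⟨$⟩ʳ i)))

inverse⇒commute : (∀ i → π ⟨$⟩ʳ (ρ ⟨$⟩ʳ i) ≡ i) → Commute π ρ
inverse⇒commute {π = π} {ρ = ρ} π∘ρ≡id = mkCommute λ i → begin
  ρ ⟨$⟩ʳ (π ⟨$⟩ʳ i)                         ≡⟨ sym (inverseˡ π) ⟩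
  flip π ⟨$⟩ʳ (π ⟨$⟩ʳ (ρ ⟨$⟩ʳ (π ⟨$⟩ʳ i)))  ≡⟨ cong (flip π ⟨$⟩ʳ_) (π∘ρ≡id (π ⟨$⟩ʳ i)) ⟩
  flip π ⟨$⟩ʳ (π ⟨$⟩ʳ i)                    ≡⟨ inverseˡ π ⟩
  i                                         ≡⟨ sym (π∘ρ≡id i) ⟩
  π ⟨$⟩ʳ (ρ ⟨$⟩ʳ i)                         ∎
  where open ≡-Reasoning

-- Cycles of duplicate-free lists

cycle-∉ : (xs : List (Fin n)) {u : Fin n} → u ∉ xs → cycle xs ⟨$⟩ʳ u ≡ u
cycle-∉ [] _ = refl
cycle-∉ (_ ∷ []) _ = refl
cycle-∉ (x ∷ y ∷ xs) u∉ =
  trans (cong (transpose x y ⟨$⟩ʳ_) (cycle-∉ (y ∷ xs) (u∉ ∘ there)))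
        (transpose-other x y (u∉ ∘ here) (λ u≡y → u∉ (there (here u≡y))))

cycle-consecutive : {xs : List (Fin n)} {u w : Fin n} →
                    Unique xs → Consecutive u w xs → cycle xs ⟨$⟩ʳ u ≡ w
cycle-consecutive {xs = u ∷ w ∷ xs} uniq here =
  trans (cong (transpose u w ⟨$⟩ʳ_) (cycle-∉ (w ∷ xs) (Unique[x∷xs]⇒x∉xs uniq)))
        (transpose-left u w)
cycle-consecutive {xs = x ∷ y ∷ xs} {w = w} uniq@(_ ∷ uniq′) (there c) =
  trans (cong (transpose x y ⟨$⟩ʳ_) (cycle-consecutive uniq′ c)) (transpose-other x y w≢x w≢y)
  where
  w≢x : w ≢ x
  w≢x refl = Unique[x∷xs]⇒x∉xs uniq (consecutive-∈ʳ c)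
  w≢y : w ≢ y
  w≢y refl = head-no-predecessor uniq′ c

cycle-last : {x z : Fin n} {xs : List (Fin n)} →
             Unique (x ∷ xs) → Last z (x ∷ xs) → cycle (x ∷ xs) ⟨$⟩ʳ z ≡ x
cycle-last _ here = refl
cycle-last {x = x} {xs = y ∷ _} (_ ∷ uniq) (there l) =
  trans (cong (transpose x y ⟨$⟩ʳ_) (cycle-last uniq l)) (transpose-right x y)

cycle-∈ : {xs : List (Fin n)} {u : Fin n} → Unique xs → u ∈ xs → cycle xs ⟨$⟩ʳ u ∈ xs
cycle-∈ {xs = xs} uniq u∈ with successor-or-last u∈
... | inj₁ (_ , c) = subst (_∈ xs) (sym (cycle-consecutive uniq c)) (consecutive-∈ʳ c)
cycle-∈ {xs = x ∷ _} uniq u∈ | inj₂ l = subst (_∈ x ∷ _) (sym (cycle-last uniq l)) (here refl)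

cycles-disjoint-commute : {xs ys : List (Fin n)} → Unique xs → Unique ys →
                          (∀ {z} → z ∈ ys → z ∉ xs) → Commute (cycle xs) (cycle ys)
cycles-disjoint-commute {xs = xs} {ys} xs-unique ys-unique disjoint = mkCommute pointwise
  where
  pointwise : (cycle xs ∘ₚ cycle ys) ≈ₚ (cycle ys ∘ₚ cycle xs)
  pointwise i with i ∈? xs | i ∈? ys
  ... | yes i∈xs | _ rewrite cycle-∉ ys (λ i∈ys → disjoint i∈ys i∈xs) =
    cycle-∉ ys (λ m → disjoint m (cycle-∈ xs-unique i∈xs))
  ... | no i∉xs | yes i∈ys rewrite cycle-∉ xs i∉xs =
    sym (cycle-∉ xs (disjoint (cycle-∈ ys-unique i∈ys)))
  ... | no i∉xs | no i∉ys rewrite cycle-∉ xs i∉xs | cycle-∉ ys i∉ys =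
    sym (cycle-∉ xs i∉xs)

module _ {x y : Fin n} {xs ys : List (Fin n)}
         (xs-unique : Unique (x ∷ xs)) (ys-unique : Unique (y ∷ ys))
         (xs⊆ys : x ∷ xs ⊆ y ∷ ys) (ys⊆xs : y ∷ ys ⊆ x ∷ xs) where

  follows⇒cycle-≈ : Follows (y ∷ ys) (x ∷ xs) → Follows (x ∷ xs) (y ∷ ys) →
                    cycle (y ∷ ys) ≈ₚ cycle (x ∷ xs)
  follows⇒cycle-≈ f f′ i with i ∈? (y ∷ ys)
  ... | no i∉ = trans (cycle-∉ (y ∷ ys) i∉) (sym (cycle-∉ (x ∷ xs) (i∉ ∘ xs⊆ys)))
  ... | yes i∈ with successor-or-last i∈
  ...   | inj₁ (_ , c) =
    trans (cycle-consecutive ys-unique c) (sym (cycle-consecutive xs-unique (f c)))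
  ...   | inj₂ l = begin
    cycle (y ∷ ys) ⟨$⟩ʳ i ≡⟨ cycle-last ys-unique l ⟩
    y                     ≡⟨ sym x≡y ⟩
    x                     ≡⟨ sym (cycle-last xs-unique i-last-in-xs) ⟩
    cycle (x ∷ xs) ⟨$⟩ʳ i ∎
    where
    open ≡-Reasoning
    x≡y : x ≡ y
    x≡y = no-predecessor⇒head (xs⊆ys (here refl)) (head-no-predecessor xs-unique ∘ f)
    i-last-in-xs : Last i (x ∷ xs)
    i-last-in-xs = no-successor⇒last (ys⊆xs i∈) (last-no-successor ys-unique l ∘ f′)

  reverses⇒cycles-inverse : Reverses (y ∷ ys) (x ∷ xs) → Reverses (x ∷ xs) (y ∷ ys) →
                            ∀ i → cycle (x ∷ xs) ⟨$⟩ʳ (cycle (y ∷ ys) ⟨$⟩ʳ i) ≡ i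
  reverses⇒cycles-inverse r r′ i with i ∈? (y ∷ ys)
  ... | no i∉ rewrite cycle-∉ (y ∷ ys) i∉ = cycle-∉ (x ∷ xs) (i∉ ∘ xs⊆ys)
  ... | yes i∈ with successor-or-last i∈
  ...   | inj₁ (_ , c) rewrite cycle-consecutive ys-unique c = cycle-consecutive xs-unique (r c)
  ...   | inj₂ l rewrite cycle-last ys-unique l = begin
    cycle (x ∷ xs) ⟨$⟩ʳ y ≡⟨ cycle-last xs-unique y-last-in-xs ⟩
    x                     ≡⟨ last-unique x-last-in-ys l ⟩
    i                     ∎
    where
    open ≡-Reasoning
    y-last-in-xs : Last y (x ∷ xs)
    y-last-in-xs = no-successor⇒last (ys⊆xs (here refl)) (head-no-predecessor ys-unique ∘ r′)
    x-last-in-ys : Last x (y ∷ ys)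
    x-last-in-ys = no-successor⇒last (xs⊆ys (here refl)) (head-no-predecessor xs-unique ∘ r)

-- Paths in graphs

module _ {n : ℕ} (F : Graph n) where

  open import Data.List.Relation.Unary.Unique.DecPropositional (_≟_ {n}) using (unique?)
  open import Data.List.Relation.Binary.Subset.DecPropositional (_≟_ {n}) using (_⊆?_)

  chain-tail : {x : Fin n} {xs : List (Fin n)} → Chain F (x ∷ xs) → Chain F xs
  chain-tail {xs = []} _ = tt
  chain-tail {xs = _ ∷ _} (_ , chain) = chain

  chain-++⁻ˡ : (xs : List (Fin n)) {ys : List (Fin n)} → Chain F (xs ++ ys) → Chain F xs
  chain-++⁻ˡ [] _ = tt
  chain-++⁻ˡ (_ ∷ []) _ = tt
  chain-++⁻ˡ (_ ∷ y ∷ xs) (adj , chain) = adj , chain-++⁻ˡ (y ∷ xs) chain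

  chain-∷ʳ : {xs : List (Fin n)} {a b : Fin n} →
             Chain F xs → Last a xs → Adj F a b → Chain F (xs ∷ʳ b)
  chain-∷ʳ _ here adj = adj , tt
  chain-∷ʳ {xs = _ ∷ _ ∷ _} (adj′ , chain) (there l) adj = adj′ , chain-∷ʳ chain l adj

  consecutive⇒adjacent : {xs : List (Fin n)} {u w : Fin n} →
                         Chain F xs → Consecutive u w xs → Adj F u w
  consecutive⇒adjacent (adj , _) here = adj
  consecutive⇒adjacent {xs = _ ∷ _} chain (there c) = consecutive⇒adjacent (chain-tail chain) c

  chain? : (xs : List (Fin n)) → Dec (Chain F xs)
  chain? [] = yes tt
  chain? (_ ∷ []) = yes tt
  chain? (x ∷ y ∷ xs) = T? (edge F x y) ×-dec chain? (y ∷ xs)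

  path? : (xs : List (Fin n)) → Dec (IsPath F xs)
  path? xs = (1 ≤? length xs) ×-dec (unique? xs ×-dec chain? xs)

  path-∷ : {x b : Fin n} {xs : List (Fin n)} →
           IsPath F (x ∷ xs) → b ∉ x ∷ xs → Adj F b x → IsPath F (b ∷ x ∷ xs)
  path-∷ {xs = xs} (_ , uniq , chain) b∉ adj = s≤s z≤n , ¬Any⇒All¬ (_ ∷ xs) b∉ ∷ uniq , adj , chain

  path-∷ʳ : {a b : Fin n} {xs : List (Fin n)} →
            IsPath F xs → b ∉ xs → Last a xs → Adj F a b → IsPath F (xs ∷ʳ b)
  path-∷ʳ {xs = _ ∷ _} (_ , uniq , chain) b∉ l adj =
    s≤s z≤n , Uniqueₚ.++⁺ uniq ([] ∷ []) (λ { (b∈ , here refl) → b∉ b∈ }) , chain-∷ʳ chain l adj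

  reach-trans : {u v w : Fin n} → Reach F u v → Reach F v w → Reach F u w
  reach-trans r here = r
  reach-trans r (step r′ adj) = step (reach-trans r r′) adj

  reach-sym : {u v : Fin n} → Reach F u v → Reach F v u
  reach-sym here = here
  reach-sym (step r adj) = reach-trans (step here (adj-sym F _ _ adj)) (reach-sym r)

  reach-from-head : {x y : Fin n} {xs : List (Fin n)} → Chain F (x ∷ xs) → y ∈ x ∷ xs → Reach F x y
  reach-from-head _ (here refl) = here
  reach-from-head {xs = _ ∷ _} (adj , chain) (there y∈) =
    reach-trans (step here adj) (reach-from-head chain y∈)

  reach-along : {xs : List (Fin n)} {u w : Fin n} → Chain F xs → u ∈ xs → w ∈ xs → Reach F u w
  reach-along {xs = _ ∷ _} chain u∈ w∈ =
    reach-trans (reach-sym (reach-from-head chain u∈)) (reach-from-head chain w∈)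

  closed-under-reach : {P : List (Fin n)} {v u : Fin n} →
                       (∀ {a b} → a ∈ P → Adj F a b → b ∈ P) → v ∈ P → Reach F v u → u ∈ P
  closed-under-reach closed v∈ here = v∈
  closed-under-reach closed v∈ (step r adj) = closed (closed-under-reach closed v∈ r) adj

  -- A longest path containing P is maximal; being duplicate-free, paths are among the finitely
  -- many lists of length at most n.
  extend-to-maximal : {P : List (Fin n)} → IsPath F P → ∃ λ Q → IsMaximalPath F Q × P ⊆ Q
  extend-to-maximal {P} P-path = Q , (Q-path , Q-maximal) , P⊆Q
    where
    Extends : List (Fin n) → Set
    Extends R = IsPath F R × P ⊆ R
    extends? : Decidable Extends
    extends? R = path? R ×-dec (P ⊆? R)
    candidates = filter extends? (listsOfLength≤ n)
    Q = argmax length P candidates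
    Q-extends : Extends Q
    Q-extends = argmax-all length (P-path , λ {_} v∈ → v∈) (all-filter extends? (listsOfLength≤ n))
    Q-path = proj₁ Q-extends
    P⊆Q = proj₂ Q-extends
    longest : ∀ {R} → Extends R → length R ≤ length Q
    longest R-extends@((_ , R-unique , _) , _) =
      All.lookup (f[xs]≤f[argmax] P candidates)
        (∈-filter⁺ extends? (∈-listsOfLength≤ (unique⇒length≤n R-unique)) R-extends)
    Q-maximal : ∀ R → IsPath F R → ¬ (Q ⊂ᵥ R)
    Q-maximal R R-path (Q⊆R , w , w∈R , w∉Q) = <⇒≱ longer (longest (R-path , Q⊆R _ ∘ P⊆Q))
      where
      longer : length Q < length R
      longer = length-mono-⊆ (¬Any⇒All¬ Q w∉Q ∷ proj₁ (proj₂ Q-path))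
                 λ { (here refl) → w∈R ; (there v∈Q) → Q⊆R _ v∈Q }

  maximal-⊆⇒⊇ : {P Q : List (Fin n)} → IsMaximalPath F P → IsPath F Q → P ⊆ Q → Q ⊆ P
  maximal-⊆⇒⊇ {P} (_ , maximal) Q-path P⊆Q {v} v∈Q with v ∈? P
  ... | yes v∈P = v∈P
  ... | no v∉P = ⊥-elim (maximal _ Q-path ((λ _ → P⊆Q) , v , v∈Q , v∉P))

  maximal-path-covers-component : {P : List (Fin n)} {v u : Fin n} → IsDisjointUnionOfPaths F →
                                  IsMaximalPath F P → v ∈ P → Reach F v u → u ∈ P
  maximal-path-covers-component {P} paths P-max@((_ , _ , P-chain) , _) v∈P v~u with paths _
  ... | R , R-path , covers = maximal-⊆⇒⊇ P-max R-path P⊆R (covers _ v~u)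
    where
    P⊆R : P ⊆ R
    P⊆R w∈P = covers _ (reach-along P-chain v∈P w∈P)

  module _ (forest : IsForest F) where

    -- Otherwise h, b, …, z with z adjacent to h would be a cycle.
    head-adjacent⇒successor : {h z : Fin n} {ys : List (Fin n)} →
                              Unique (h ∷ ys) → Chain F (h ∷ ys) → z ∈ ys → Adj F h z →
                              Consecutive h z (h ∷ ys)
    head-adjacent⇒successor {h} {z} uniq chain z∈ adj with ∈-∃++ z∈
    ... | [] , _ , refl = here
    ... | b ∷ bs , zs , refl = ⊥-elim (forest C (3≤length , C-unique , C-chain , closing))
      where
      C = h ∷ b ∷ bs ∷ʳ z
      split : h ∷ b ∷ bs ++ z ∷ zs ≡ C ++ zs
      split = cong (λ t → h ∷ b ∷ t) (sym (++-assoc bs [ z ] zs))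
      3≤length : 3 ≤ length C
      3≤length = s≤s (s≤s (subst (1 ≤_) (sym (length-++ bs)) (m≤n+m 1 (length bs))))
      C-unique : Unique C
      C-unique = unique-++⁻ˡ C (subst Unique split uniq)
      C-chain : Chain F C
      C-chain = chain-++⁻ˡ C (subst (Chain F) split chain)
      closing : ∀ y → last C ≡ just y → Adj F y h
      closing y last≡y with refl ← just-injective (trans (sym (last-∷ʳ (h ∷ b ∷ bs))) last≡y) =
        adj-sym F _ _ adj

    adjacent⇒consecutive : {xs : List (Fin n)} {u w : Fin n} →
                           Unique xs → Chain F xs → u ∈ xs → w ∈ xs → Adj F u w →
                           Consecutive u w xs ⊎ Consecutive w u xs
    adjacent⇒consecutive _ _ (here refl) (here refl) adj = ⊥-elim (irref F _ adj)
    adjacent⇒consecutive uniq chain (here refl) (there w∈) adj =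
      inj₁ (head-adjacent⇒successor uniq chain w∈ adj)
    adjacent⇒consecutive uniq chain (there u∈) (here refl) adj =
      inj₂ (head-adjacent⇒successor uniq chain u∈ (adj-sym F _ _ adj))
    adjacent⇒consecutive {xs = _ ∷ _} (_ ∷ uniq) chain (there u∈) (there w∈) adj =
      Sum.map there there (adjacent⇒consecutive uniq (chain-tail chain) u∈ w∈ adj)

    path-follows-or-reverses : {xs ys : List (Fin n)} →
                               Unique xs → Chain F xs → Unique ys → Chain F ys → ys ⊆ xs →
                               Follows ys xs ⊎ Reverses ys xs
    path-follows-or-reverses xs-unique xs-chain ys-unique ys-chain ys⊆xs =
      follows-or-reverses xs-unique ys-unique λ c →
        adjacent⇒consecutive xs-unique xs-chain (ys⊆xs (consecutive-∈ˡ c)) (ys⊆xs (consecutive-∈ʳ c))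
          (consecutive⇒adjacent ys-chain c)

    cycles-on-same-vertices-commute :
      {x y : Fin n} {xs ys : List (Fin n)} →
      Unique (x ∷ xs) → Chain F (x ∷ xs) → Unique (y ∷ ys) → Chain F (y ∷ ys) →
      x ∷ xs ⊆ y ∷ ys → y ∷ ys ⊆ x ∷ xs → Commute (cycle (x ∷ xs)) (cycle (y ∷ ys))
    cycles-on-same-vertices-commute xs-unique xs-chain ys-unique ys-chain xs⊆ys ys⊆xs
      with mutually-follow-or-reverse xs-unique ys-unique
             (path-follows-or-reverses xs-unique xs-chain ys-unique ys-chain ys⊆xs)
             (path-follows-or-reverses ys-unique ys-chain xs-unique xs-chain xs⊆ys)
    ... | inj₁ (f , f′) =
      ≈ₚ⇒commute (sym ∘ follows⇒cycle-≈ xs-unique ys-unique xs⊆ys ys⊆xs f f′)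
    ... | inj₂ (r , r′) =
      inverse⇒commute (reverses⇒cycles-inverse xs-unique ys-unique xs⊆ys ys⊆xs r r′)

    maximal-cycles-commute : IsDisjointUnionOfPaths F → (P Q : List (Fin n)) →
                             IsMaximalPath F P → IsMaximalPath F Q → Commute (cycle P) (cycle Q)
    maximal-cycles-commute _ [] _ ((() , _) , _) _
    maximal-cycles-commute _ _ [] _ ((() , _) , _)
    maximal-cycles-commute paths P@(_ ∷ _) Q@(_ ∷ _) P-max@(P-path@(_ , P-unique , P-chain) , _)
                                                     Q-max@((_ , Q-unique , Q-chain) , _)
      with any? (_∈? P) Q
    ... | no disjoint =
      cycles-disjoint-commute P-unique Q-unique (λ z∈Q z∈P → disjoint (lose z∈Q z∈P))
    ... | yes meet with find meet
    ...   | z , z∈Q , z∈P =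
      cycles-on-same-vertices-commute P-unique P-chain Q-unique Q-chain P⊆Q Q⊆P
      where
      Q⊆P : Q ⊆ P
      Q⊆P w∈Q = maximal-path-covers-component paths P-max z∈P (reach-along Q-chain z∈Q w∈Q)
      P⊆Q : P ⊆ Q
      P⊆Q = maximal-⊆⇒⊇ Q-max P-path Q⊆P

    module _ (abelian : ChainGroupAbelian F) where

      no-branch-off-maximal-path : {P : List (Fin n)} {x a y b : Fin n} → IsMaximalPath F P →
                                   Consecutive x a P → Consecutive a y P → b ∉ P → ¬ Adj F a b
      no-branch-off-maximal-path {P} {x} {a} {y} {b} P-max@((_ , P-unique , P-chain) , _)
                                 x→a a→y b∉ a~b
        with extend-to-maximal {x ∷ a ∷ b ∷ []} (s≤s z≤n , xab-unique , x~a , a~b , tt)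
        where
        x~a = consecutive⇒adjacent P-chain x→a
        xab-unique : Unique (x ∷ a ∷ b ∷ [])
        xab-unique = (consecutive-≢ P-unique x→a ∷ (λ { refl → b∉ (consecutive-∈ˡ x→a) }) ∷ [])
                   ∷ ((λ { refl → b∉ (consecutive-∈ˡ a→y) }) ∷ [])
                   ∷ [] ∷ []
      ... | Q , Q-max@((_ , Q-unique , Q-chain) , _) , xab⊆Q
        with adjacent⇒consecutive Q-unique Q-chain (xab⊆Q (here refl)) (xab⊆Q (there (here refl)))
               (consecutive⇒adjacent P-chain x→a)
           | adjacent⇒consecutive Q-unique Q-chain (xab⊆Q (there (here refl)))
               (xab⊆Q (there (there (here refl)))) a~b
      ... | inj₁ x→a′ | inj₁ a→b′ = b∉ (subst (_∈ P) (sym b≡y) (consecutive-∈ʳ a→y))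
        where
        open ≡-Reasoning
        b≡y : b ≡ y
        b≡y = begin
          b                              ≡⟨ sym (cycle-consecutive Q-unique a→b′) ⟩
          cycle Q ⟨$⟩ʳ a                 ≡⟨ cong (cycle Q ⟨$⟩ʳ_) (sym (cycle-consecutive P-unique x→a)) ⟩
          cycle Q ⟨$⟩ʳ (cycle P ⟨$⟩ʳ x)  ≡⟨ abelian (cycle P) (cycle Q) (gen P P-max) (gen Q Q-max) x ⟩
          cycle P ⟨$⟩ʳ (cycle Q ⟨$⟩ʳ x)  ≡⟨ cong (cycle P ⟨$⟩ʳ_) (cycle-consecutive Q-unique x→a′) ⟩
          cycle P ⟨$⟩ʳ a                 ≡⟨ cycle-consecutive P-unique a→y ⟩
          y                              ∎
      ... | inj₁ x→a′ | inj₂ b→a′ =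
        b∉ (subst (_∈ P) (predecessor-unique Q-unique x→a′ b→a′) (consecutive-∈ˡ x→a))
      ... | inj₂ a→x′ | inj₁ a→b′ =
        b∉ (subst (_∈ P) (successor-unique Q-unique a→x′ a→b′) (consecutive-∈ˡ x→a))
      ... | inj₂ a→x′ | inj₂ b→a′ = consecutive-≢ P-unique a→y a≡y
        where
        open ≡-Reasoning
        a≡y : a ≡ y
        a≡y = begin
          a                              ≡⟨ sym (cycle-consecutive Q-unique b→a′) ⟩
          cycle Q ⟨$⟩ʳ b                 ≡⟨ cong (cycle Q ⟨$⟩ʳ_) (sym (cycle-∉ P b∉)) ⟩
          cycle Q ⟨$⟩ʳ (cycle P ⟨$⟩ʳ b)  ≡⟨ abelian (cycle P) (cycle Q) (gen P P-max) (gen Q Q-max) b ⟩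
          cycle P ⟨$⟩ʳ (cycle Q ⟨$⟩ʳ b)  ≡⟨ cong (cycle P ⟨$⟩ʳ_) (cycle-consecutive Q-unique b→a′) ⟩
          cycle P ⟨$⟩ʳ a                 ≡⟨ cycle-consecutive P-unique a→y ⟩
          y                              ∎

      maximal-path-closed : {P : List (Fin n)} {a b : Fin n} →
                            IsMaximalPath F P → a ∈ P → Adj F a b → b ∈ P
      maximal-path-closed {[]} ((() , _) , _) _ _
      maximal-path-closed {P@(_ ∷ _)} {a} {b} P-max@(P-path , _) a∈ a~b with b ∈? P
      ... | yes b∈ = b∈
      ... | no b∉ with head-or-predecessor a∈
      ...   | inj₁ refl =
        ⊥-elim (b∉ (maximal-⊆⇒⊇ P-max (path-∷ P-path b∉ (adj-sym F _ _ a~b)) there (here refl)))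
      ...   | inj₂ (x , x→a) with successor-or-last a∈
      ...     | inj₁ (y , a→y) = ⊥-elim (no-branch-off-maximal-path P-max x→a a→y b∉ a~b)
      ...     | inj₂ l =
        ⊥-elim (b∉ (maximal-⊆⇒⊇ P-max (path-∷ʳ P-path b∉ l a~b) ∈-++⁺ˡ (∈-++⁺ʳ P (here refl))))

      abelian⇒disjoint-union-of-paths : IsDisjointUnionOfPaths F
      abelian⇒disjoint-union-of-paths v with extend-to-maximal {[ v ]} (s≤s z≤n , [] ∷ [] , tt)
      ... | P , P-max , v⊆P =
        P , proj₁ P-max , λ _ → closed-under-reach (maximal-path-closed P-max) (v⊆P (here refl))

  centralises-chain-group : (∀ P → IsMaximalPath F P → Commute π (cycle P)) →
                            InChainGroup F ρ → Commute π ρ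
  centralises-chain-group commutes (gen P P-max) = commutes P P-max
  centralises-chain-group commutes one = commute-id
  centralises-chain-group commutes (mul g h) =
    commute-∘ (centralises-chain-group commutes g) (centralises-chain-group commutes h)
  centralises-chain-group commutes (inv g) = commute-flip (centralises-chain-group commutes g)
  centralises-chain-group commutes (resp ρ≈σ g) =
    commute-resp ρ≈σ (centralises-chain-group commutes g)

  generators-commute⇒abelian :
    (∀ P Q → IsMaximalPath F P → IsMaximalPath F Q → Commute (cycle P) (cycle Q)) →
    ChainGroupAbelian F
  generators-commute⇒abelian commute π ρ π∈ ρ∈ = Commute.pointwise $
    centralises-chain-group
      (λ Q Q-max → commute-sym (centralises-chain-group (λ P P-max → commute Q P Q-max P-max) π∈))
      ρ∈

mainTheorem3 : (n : ℕ) (F : Graph n) → IsForest F →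
    ChainGroupAbelian F ⇔ IsDisjointUnionOfPaths F
mainTheorem3 n F forest =
  mk⇔ (abelian⇒disjoint-union-of-paths F forest)
      (λ paths → generators-commute⇒abelian F (maximal-cycles-commute F forest paths))
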